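{- Let $f\in\mathbb{Q}[X]$ be a polynomial of degree $d\geqslant 1$. Then there is a constant $C>0$ depending only on $f$ such that for every $n\geqslant 1$, $$h\left(\mathrm{Res}\left(f^{(n)},f'\right)\right)\leqslant C d^n.$$
   Context: The iterates of $f$ are $f^{(0)}(X)=X$ and $f^{(n)}(X)=f(f^{(n-1)}(X))$ for $n\ge1$; $\mathrm{Res}(\cdot,\cdot)$ is the resultant of two polynomials and $f'$ is the derivative of $f$. For a rational number $a/b$ in lowest terms, the Weil logarithmic height is $h(a/b)=\max\{\log|a|,\log|b|\}$, with the convention $h(0)=0$. -}

module Defs where

open import Data.Nat as ℕ using (ℕ; zero; suc; _∸_; _≤ᵇ_)
open import Data.Bool using (Bool; true; false; if_then_else_; _∧_)
open import Data.Integer using (ℤ; +_)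
open import Data.Rational as ℚ using (ℚ; 0ℚ; 1ℚ; _+_; _*_; -_; _/_)
open import Data.Rational.Properties using (_≟_)
open import Data.List using (List; []; _∷_; length; reverse; dropWhile)
open import Data.Fin using (Fin; zero; suc; punchIn; toℕ)
open import Relation.Nullary.Decidable using (¬?)

-- Polynomials over ℚ as little-endian coefficient lists:
-- (a₀ ∷ a₁ ∷ … ∷ aₖ ∷ []) represents a₀ + a₁ X + … + aₖ Xᵏ.
-- Trailing zeros are allowed; `trim` removes them.

Poly : Set
Poly = List ℚ

trim : Poly → Poly
trim p = reverse (dropWhile (_≟ 0ℚ) (reverse p))

-- degree (the zero polynomial gets degree 0, irrelevant here)
deg : Poly → ℕ
deg p = length (trim p) ∸ 1

coef : Poly → ℕ → ℚ
coef []       _       = 0ℚ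
coef (a ∷ p)  zero    = a
coef (a ∷ p)  (suc t) = coef p t

padd : Poly → Poly → Poly
padd []      q       = q
padd p       []      = p
padd (a ∷ p) (b ∷ q) = (a + b) ∷ padd p q

scale : ℚ → Poly → Poly
scale c []      = []
scale c (a ∷ p) = (c * a) ∷ scale c p

pmul : Poly → Poly → Poly
pmul []      q = []
pmul (a ∷ p) q = padd (scale a q) (0ℚ ∷ pmul p q)

pcomp : Poly → Poly → Poly
pcomp []      q = []
pcomp (a ∷ p) q = padd (a ∷ []) (pmul q (pcomp p q))

iter : Poly → ℕ → Poly
iter f zero    = 0ℚ ∷ 1ℚ ∷ []
iter f (suc n) = pcomp f (iter f n)

derivAux : ℕ → Poly → Poly
derivAux k []      = []
derivAux k (a ∷ p) = ((+ k / 1) * a) ∷ derivAux (suc k) p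

deriv : Poly → Poly
deriv []      = []
deriv (a ∷ p) = derivAux 1 p

sumFin : (n : ℕ) → (Fin n → ℚ) → ℚ
sumFin zero    g = 0ℚ
sumFin (suc n) g = g zero + sumFin n (λ i → g (suc i))

sign : ℕ → ℚ
sign zero    = 1ℚ
sign (suc k) = - sign k

det : (n : ℕ) → (Fin n → Fin n → ℚ) → ℚ
det zero    M = 1ℚ
det (suc n) M =
  sumFin (suc n) (λ j → sign (toℕ j) * (M zero j * det n (λ r c → M (suc r) (punchIn j c))))

-- For p of degree m and q of degree k, the Sylvester matrix is (m+k)×(m+k):
-- rows i < k hold the coefficients p_m … p_0 shifted right by i,
-- rows k+i (i < m) hold q_k … q_0 shifted right by i.

shifted : Poly → ℕ → ℕ → ℕ → ℚ
shifted p e i j =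
  if (i ≤ᵇ j) ∧ ((j ∸ i) ≤ᵇ e) then coef p (e ∸ (j ∸ i)) else 0ℚ

sylvester : Poly → Poly → (m k : ℕ) → Fin (m ℕ.+ k) → Fin (m ℕ.+ k) → ℚ
sylvester p q m k r c =
  if suc (toℕ r) ≤ᵇ k
    then shifted p m (toℕ r) (toℕ c)
    else shifted q k (toℕ r ∸ k) (toℕ c)

Res : Poly → Poly → ℚ
Res p q = det (deg p ℕ.+ deg q) (sylvester p q (deg p) (deg q))

-- Write Bₙ for a bound on both a common denominator and the ℓ¹-norm of the scaled numerators
-- of f⁽ⁿ⁾. Composing with f by Horner's scheme gives Bₙ₊₁ = B · Bₙ ^ d, hence
-- Bₙ = B ^ (1 + d + ⋯ + dⁿ⁻¹), while deg f⁽ⁿ⁾ ≤ dⁿ. Expanding the Sylvester determinant along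
-- its rows bounds Res (f⁽ⁿ⁾, f′), numerator and denominator alike, by the product of the row
-- norms: at most d - 1 rows built from f⁽ⁿ⁾, each of norm ≤ (dⁿ + 1) Bₙ, and at most dⁿ rows
-- built from f′, each of norm ≤ d ‖f′‖. Since Bₙ ^ (d - 1) · B = B ^ (dⁿ) and dⁿ + 1 ≤ 2 ^ (dⁿ),
-- this product is at most (2 ^ (d - 1) · B · d ‖f′‖) ^ (dⁿ).

{-# OPTIONS --safe #-}
module Submission where

open import Defs
open import Data.Nat as ℕ
  using (ℕ; zero; suc; z≤n; s≤s; NonZero; _≤_; _+_; _*_; _^_; _∸_; _⊓_; _≤ᵇ_)
import Data.Nat.Properties as ℕP
open import Data.Nat.Divisibility using (divides; ∣⇒≤)
import Data.Nat.Coprimality as Coprime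
open import Data.Nat.Tactic.RingSolver as ℕSolver using ()
open import Data.Integer as ℤ using (ℤ; +_; ∣_∣)
import Data.Integer.Properties as ℤP
open import Data.Integer.Tactic.RingSolver as ℤSolver using ()
open import Data.Rational as ℚ using (ℚ; mkℚ; ↥_; ↧_; ↧ₙ_; 0ℚ; 1ℚ)
import Data.Rational.Properties as ℚP
import Data.Rational.Unnormalised as ℚᵘ
open import Data.Product using (∃; _×_; _,_; proj₁; proj₂)
open import Data.List using ([]; _∷_; _++_; length; reverse; drop; take; dropWhile; takeWhile)
import Data.List.Properties as LP
open import Data.List.Relation.Unary.All using (All; []; _∷_)
import Data.List.Relation.Unary.All.Properties as AllP
open import Data.Fin using (Fin; zero; suc; toℕ; punchIn)
open import Data.Vec.Functional using (foldr; removeAt)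
open import Algebra.Properties.CommutativeMonoid.Sum ℕP.+-0-commutativeMonoid using (sum; sum-remove; sum-cong-≗; sum-replicate-zero)
open import Algebra.Properties.Semiring.Sum ℕP.+-*-semiring using (*-distribʳ-sum)
open import Function using (_∘_)
open import Data.Bool using (Bool; true; false; if_then_else_; _∧_)
open import Relation.Binary.PropositionalEquality

-- Bounded rationals

↥-+-cross : ∀ x y → ↥ (x ℚ.+ y) ℤ.* (↧ x ℤ.* ↧ y) ≡ (↥ x ℤ.* ↧ y ℤ.+ ↥ y ℤ.* ↧ x) ℤ.* ↧ (x ℚ.+ y)
↥-+-cross x@(mkℚ _ _ _) y@(mkℚ _ _ _) with ℚP.toℚᵘ-homo-+ x y
... | ℚᵘ.*≡* eq =
  trans (cong (ℤ._* (↧ x ℤ.* ↧ y)) (sym (ℚP.↥ᵘ-toℚᵘ (x ℚ.+ y))))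
    (trans eq (cong ((↥ x ℤ.* ↧ y ℤ.+ ↥ y ℤ.* ↧ x) ℤ.*_) (ℚP.↧ᵘ-toℚᵘ (x ℚ.+ y))))

↥-*-cross : ∀ x y → ↥ (x ℚ.* y) ℤ.* (↧ x ℤ.* ↧ y) ≡ (↥ x ℤ.* ↥ y) ℤ.* ↧ (x ℚ.* y)
↥-*-cross x@(mkℚ _ _ _) y@(mkℚ _ _ _) with ℚP.toℚᵘ-homo-* x y
... | ℚᵘ.*≡* eq =
  trans (cong (ℤ._* (↧ x ℤ.* ↧ y)) (sym (ℚP.↥ᵘ-toℚᵘ (x ℚ.* y))))
    (trans eq (cong ((↥ x ℤ.* ↥ y) ℤ.*_) (ℚP.↧ᵘ-toℚᵘ (x ℚ.* y))))

-- E · x is an integer of absolute value at most b.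
record ScaledInt (E b : ℕ) (x : ℚ) : Set where
  constructor scaledInt
  field
    num  : ℤ
    ∣num∣≤ : ∣ num ∣ ≤ b
    ↥*E≡num*↧ : ↥ x ℤ.* + E ≡ num ℤ.* ↧ x

scaledInt-mono : ∀ {E b b′ x} → b ≤ b′ → ScaledInt E b x → ScaledInt E b′ x
scaledInt-mono b≤b′ (scaledInt a a≤b eq) = scaledInt a (ℕP.≤-trans a≤b b≤b′) eq

scaledInt-0 : ∀ {E} → ScaledInt E 0 0ℚ
scaledInt-0 = scaledInt (+ 0) z≤n refl

scaledInt-1 : ScaledInt 1 1 1ℚ
scaledInt-1 = scaledInt (+ 1) ℕP.≤-refl refl

scaledInt-self : ∀ x → ScaledInt (↧ₙ x) ∣ ↥ x ∣ x
scaledInt-self (mkℚ n _ _) = scaledInt n ℕP.≤-refl refl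

↧*↧-nonZero : ∀ x y → ℤ.NonZero (↧ x ℤ.* ↧ y)
↧*↧-nonZero (mkℚ _ _ _) (mkℚ _ _ _) = _

scaledInt-+ : ∀ {E b c x y} → ScaledInt E b x → ScaledInt E c y → ScaledInt E (b + c) (x ℚ.+ y)
scaledInt-+ {E} {x = x} {y} (scaledInt a₁ a₁≤ e₁) (scaledInt a₂ a₂≤ e₂) =
  scaledInt (a₁ ℤ.+ a₂) (ℕP.≤-trans (ℤP.∣i+j∣≤∣i∣+∣j∣ a₁ a₂) (ℕP.+-mono-≤ a₁≤ a₂≤))
    (ℤP.*-cancelʳ-≡ _ _ (↧ x ℤ.* ↧ y) {{↧*↧-nonZero x y}} (begin
      (↥ s ℤ.* + E) ℤ.* (↧ x ℤ.* ↧ y)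
        ≡⟨ swap₂₃ (↥ s) (+ E) (↧ x ℤ.* ↧ y) ⟩
      (↥ s ℤ.* (↧ x ℤ.* ↧ y)) ℤ.* + E
        ≡⟨ cong (ℤ._* + E) (↥-+-cross x y) ⟩
      ((↥ x ℤ.* ↧ y ℤ.+ ↥ y ℤ.* ↧ x) ℤ.* ↧ s) ℤ.* + E
        ≡⟨ distribute (↥ x) (↥ y) (↧ x) (↧ y) (+ E) (↧ s) ⟩
      ((↥ x ℤ.* + E) ℤ.* ↧ y ℤ.+ (↥ y ℤ.* + E) ℤ.* ↧ x) ℤ.* ↧ s
        ≡⟨ cong₂ (λ u v → (u ℤ.* ↧ y ℤ.+ v ℤ.* ↧ x) ℤ.* ↧ s) e₁ e₂ ⟩
      ((a₁ ℤ.* ↧ x) ℤ.* ↧ y ℤ.+ (a₂ ℤ.* ↧ y) ℤ.* ↧ x) ℤ.* ↧ s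
        ≡⟨ collect a₁ a₂ (↧ x) (↧ y) (↧ s) ⟩
      ((a₁ ℤ.+ a₂) ℤ.* ↧ s) ℤ.* (↧ x ℤ.* ↧ y) ∎))
  where
  open ≡-Reasoning
  s = x ℚ.+ y
  swap₂₃ : ∀ (u v w : ℤ) → (u ℤ.* v) ℤ.* w ≡ (u ℤ.* w) ℤ.* v
  swap₂₃ = ℤSolver.solve-∀
  distribute : ∀ (X Y U V E S : ℤ) →
    ((X ℤ.* V ℤ.+ Y ℤ.* U) ℤ.* S) ℤ.* E ≡ ((X ℤ.* E) ℤ.* V ℤ.+ (Y ℤ.* E) ℤ.* U) ℤ.* S
  distribute = ℤSolver.solve-∀
  collect : ∀ (a b U V S : ℤ) →
    ((a ℤ.* U) ℤ.* V ℤ.+ (b ℤ.* V) ℤ.* U) ℤ.* S ≡ ((a ℤ.+ b) ℤ.* S) ℤ.* (U ℤ.* V)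
  collect = ℤSolver.solve-∀

scaledInt-* : ∀ {E F b c x y} → ScaledInt E b x → ScaledInt F c y → ScaledInt (E * F) (b * c) (x ℚ.* y)
scaledInt-* {E} {F} {b} {c} {x} {y} (scaledInt a₁ a₁≤ e₁) (scaledInt a₂ a₂≤ e₂) =
  scaledInt (a₁ ℤ.* a₂) (subst (_≤ b * c) (sym (ℤP.abs-* a₁ a₂)) (ℕP.*-mono-≤ a₁≤ a₂≤))
    (ℤP.*-cancelʳ-≡ _ _ (↧ x ℤ.* ↧ y) {{↧*↧-nonZero x y}} (begin
      (↥ p ℤ.* + (E * F)) ℤ.* (↧ x ℤ.* ↧ y)
        ≡⟨ cong (λ u → (↥ p ℤ.* u) ℤ.* (↧ x ℤ.* ↧ y)) (ℤP.pos-* E F) ⟩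
      (↥ p ℤ.* (+ E ℤ.* + F)) ℤ.* (↧ x ℤ.* ↧ y)
        ≡⟨ swap₂₃ (↥ p) (+ E ℤ.* + F) (↧ x ℤ.* ↧ y) ⟩
      (↥ p ℤ.* (↧ x ℤ.* ↧ y)) ℤ.* (+ E ℤ.* + F)
        ≡⟨ cong (ℤ._* (+ E ℤ.* + F)) (↥-*-cross x y) ⟩
      ((↥ x ℤ.* ↥ y) ℤ.* ↧ p) ℤ.* (+ E ℤ.* + F)
        ≡⟨ regroup (↥ x) (↥ y) (↧ p) (+ E) (+ F) ⟩
      ((↥ x ℤ.* + E) ℤ.* (↥ y ℤ.* + F)) ℤ.* ↧ p
        ≡⟨ cong₂ (λ u v → (u ℤ.* v) ℤ.* ↧ p) e₁ e₂ ⟩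
      ((a₁ ℤ.* ↧ x) ℤ.* (a₂ ℤ.* ↧ y)) ℤ.* ↧ p
        ≡⟨ sym (regroup a₁ a₂ (↧ p) (↧ x) (↧ y)) ⟩
      ((a₁ ℤ.* a₂) ℤ.* ↧ p) ℤ.* (↧ x ℤ.* ↧ y) ∎))
  where
  open ≡-Reasoning
  p = x ℚ.* y
  swap₂₃ : ∀ (u v w : ℤ) → (u ℤ.* v) ℤ.* w ≡ (u ℤ.* w) ℤ.* v
  swap₂₃ = ℤSolver.solve-∀
  regroup : ∀ (X Y P U V : ℤ) → ((X ℤ.* Y) ℤ.* P) ℤ.* (U ℤ.* V) ≡ ((X ℤ.* U) ℤ.* (Y ℤ.* V)) ℤ.* P
  regroup = ℤSolver.solve-∀

scaledInt-rescale : ∀ {E b x} k → ScaledInt E b x → ScaledInt (E * k) (b * k) x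
scaledInt-rescale {E} {b} {x} k (scaledInt a a≤b eq) =
  scaledInt (a ℤ.* + k) (subst (_≤ b * k) (sym (ℤP.abs-* a (+ k))) (ℕP.*-monoˡ-≤ k a≤b)) (begin
    ↥ x ℤ.* + (E * k)       ≡⟨ cong (↥ x ℤ.*_) (ℤP.pos-* E k) ⟩
    ↥ x ℤ.* (+ E ℤ.* + k)   ≡⟨ ℤP.*-assoc (↥ x) (+ E) (+ k) ⟨
    (↥ x ℤ.* + E) ℤ.* + k   ≡⟨ cong (ℤ._* + k) eq ⟩
    (a ℤ.* ↧ x) ℤ.* + k     ≡⟨ swap₂₃ a (↧ x) (+ k) ⟩
    (a ℤ.* + k) ℤ.* ↧ x     ∎)
  where
  open ≡-Reasoning
  swap₂₃ : ∀ (u v w : ℤ) → (u ℤ.* v) ℤ.* w ≡ (u ℤ.* w) ℤ.* v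
  swap₂₃ = ℤSolver.solve-∀

scaledInt-neg : ∀ {E b x} → ScaledInt E b x → ScaledInt E b (ℚ.- x)
scaledInt-neg {E} {b} {x} (scaledInt a a≤b eq) =
  scaledInt (ℤ.- a) (subst (_≤ b) (sym (ℤP.∣-i∣≡∣i∣ a)) a≤b) (begin
    ↥ (ℚ.- x) ℤ.* + E   ≡⟨ cong (ℤ._* + E) (ℚP.↥-neg x) ⟩
    ℤ.- ↥ x ℤ.* + E     ≡⟨ ℤP.neg-distribˡ-* (↥ x) (+ E) ⟨
    ℤ.- (↥ x ℤ.* + E)   ≡⟨ cong ℤ.-_ eq ⟩
    ℤ.- (a ℤ.* ↧ x)     ≡⟨ ℤP.neg-distribˡ-* a (↧ x) ⟩
    ℤ.- a ℤ.* ↧ x       ≡⟨ cong (ℤ.- a ℤ.*_) (ℚP.↧-neg x) ⟨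
    ℤ.- a ℤ.* ↧ (ℚ.- x) ∎)
  where open ≡-Reasoning

scaledInt-sign : ∀ {E b y} k → ScaledInt E b y → ScaledInt E b (sign k ℚ.* y)
scaledInt-sign {E} {b} {y} zero h = subst (ScaledInt E b) (sym (ℚP.*-identityˡ y)) h
scaledInt-sign {E} {b} {y} (suc k) h =
  subst (ScaledInt E b) (ℚP.neg-distribˡ-* (sign k) y) (scaledInt-neg (scaledInt-sign k h))

-- x = num / E with ↥ x / ↧ x in lowest terms, so ↧ x divides E.
scaledInt⇒bounds : ∀ {E b x} → 1 ≤ E → ScaledInt E b x → ↧ₙ x ≤ E × ∣ ↥ x ∣ ≤ b
scaledInt⇒bounds {E} {b} {mkℚ n d coprime} 1≤E (scaledInt a a≤b eq) =
  ↧≤E , ℕP.≤-trans ∣n∣≤∣a∣ a≤b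
  where
  instance
    _ : NonZero E
    _ = ℕ.>-nonZero 1≤E
  ∣n∣*E≡∣a∣*↧ : ∣ n ∣ * E ≡ ∣ a ∣ * suc d
  ∣n∣*E≡∣a∣*↧ = trans (sym (ℤP.abs-* n (+ E))) (trans (cong ∣_∣ eq) (ℤP.abs-* a (+ suc d)))
  ↧≤E : suc d ≤ E
  ↧≤E = ∣⇒≤ (Coprime.coprime-divisor (Coprime.sym (Coprime.recompute coprime)) (divides ∣ a ∣ ∣n∣*E≡∣a∣*↧))
  ∣n∣≤∣a∣ : ∣ n ∣ ≤ ∣ a ∣
  ∣n∣≤∣a∣ = ℕP.*-cancelʳ-≤ _ _ E (subst (_≤ ∣ a ∣ * E) (sym ∣n∣*E≡∣a∣*↧) (ℕP.*-monoʳ-≤ ∣ a ∣ ↧≤E))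

-- Degree bounds

Zeros : Poly → Set
Zeros = All (_≡ 0ℚ)

DegreeAtMost : ℕ → Poly → Set
DegreeAtMost D p = Zeros (drop (suc D) p)

zeros-padd : ∀ {p q} → Zeros p → Zeros q → Zeros (padd p q)
zeros-padd []          zq          = zq
zeros-padd (z ∷ zp)    []          = z ∷ zp
zeros-padd (refl ∷ zp) (refl ∷ zq) = ℚP.+-identityˡ 0ℚ ∷ zeros-padd zp zq

zeros-scale : ∀ a {q} → Zeros q → Zeros (scale a q)
zeros-scale a []         = []
zeros-scale a (refl ∷ z) = ℚP.*-zeroʳ a ∷ zeros-scale a z

zeros-scale-0 : ∀ q → Zeros (scale 0ℚ q)
zeros-scale-0 []      = []
zeros-scale-0 (b ∷ q) = ℚP.*-zeroˡ b ∷ zeros-scale-0 q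

zeros-pmulˡ : ∀ {p} q → Zeros p → Zeros (pmul p q)
zeros-pmulˡ q []         = []
zeros-pmulˡ q (refl ∷ z) = zeros-padd (zeros-scale-0 q) (refl ∷ zeros-pmulˡ q z)

zeros-pmulʳ : ∀ p {q} → Zeros q → Zeros (pmul p q)
zeros-pmulʳ []      z = []
zeros-pmulʳ (a ∷ p) z = zeros-padd (zeros-scale a z) (refl ∷ zeros-pmulʳ p z)

zeros-pcomp : ∀ {p} q → Zeros p → Zeros (pcomp p q)
zeros-pcomp q []         = []
zeros-pcomp q (refl ∷ z) = zeros-padd (refl ∷ []) (zeros-pmulʳ q (zeros-pcomp q z))

zeros-derivAux : ∀ k {p} → Zeros p → Zeros (derivAux k p)
zeros-derivAux k []         = []
zeros-derivAux k (refl ∷ z) = ℚP.*-zeroʳ (+ k ℚ./ 1) ∷ zeros-derivAux (suc k) z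

zeros-reverse : ∀ {p} → Zeros p → Zeros (reverse p)
zeros-reverse {[]}    []       = []
zeros-reverse {a ∷ p} (z ∷ zp) =
  subst Zeros (sym (LP.unfold-reverse a p)) (AllP.++⁺ (zeros-reverse zp) (z ∷ []))

degreeAtMost-zeros : ∀ D {p} → Zeros p → DegreeAtMost D p
degreeAtMost-zeros D = AllP.drop⁺ (suc D)

degreeAtMost-mono : ∀ {D D′} p → D ≤ D′ → DegreeAtMost D p → DegreeAtMost D′ p
degreeAtMost-mono {D} {D′} p D≤D′ z =
  subst Zeros (trans (LP.drop-drop (suc D) (D′ ∸ D) p) (cong (λ t → drop (suc t) p) (ℕP.m+[n∸m]≡n D≤D′)))
    (AllP.drop⁺ (D′ ∸ D) z)

degreeAtMost-padd : ∀ D p q → DegreeAtMost D p → DegreeAtMost D q → DegreeAtMost D (padd p q)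
degreeAtMost-padd D       []      q       zp zq = zq
degreeAtMost-padd D       (a ∷ p) []      zp zq = zp
degreeAtMost-padd zero    (a ∷ p) (b ∷ q) zp zq = zeros-padd zp zq
degreeAtMost-padd (suc D) (a ∷ p) (b ∷ q) zp zq = degreeAtMost-padd D p q zp zq

degreeAtMost-scale : ∀ D a q → DegreeAtMost D q → DegreeAtMost D (scale a q)
degreeAtMost-scale D       a []      z = []
degreeAtMost-scale zero    a (b ∷ q) z = zeros-scale a z
degreeAtMost-scale (suc D) a (b ∷ q) z = degreeAtMost-scale D a q z

degreeAtMost-pmul : ∀ D D′ p q → DegreeAtMost D p → DegreeAtMost D′ q → DegreeAtMost (D + D′) (pmul p q)
degreeAtMost-pmul D       D′ []      q zp zq = []
degreeAtMost-pmul zero    D′ (a ∷ p) q zp zq =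
  degreeAtMost-padd D′ (scale a q) (0ℚ ∷ pmul p q)
    (degreeAtMost-scale D′ a q zq) (degreeAtMost-zeros D′ (refl ∷ zeros-pmulˡ q zp))
degreeAtMost-pmul (suc D) D′ (a ∷ p) q zp zq =
  degreeAtMost-padd (suc D + D′) (scale a q) (0ℚ ∷ pmul p q)
    (degreeAtMost-scale (suc D + D′) a q (degreeAtMost-mono q (ℕP.m≤n+m D′ (suc D)) zq))
    (degreeAtMost-pmul D D′ p q zp zq)

degreeAtMost-pcomp : ∀ D D′ p q → DegreeAtMost D p → DegreeAtMost D′ q → DegreeAtMost (D * D′) (pcomp p q)
degreeAtMost-pcomp D       D′ []      q zp zq = []
degreeAtMost-pcomp zero    D′ (a ∷ p) q zp zq =
  degreeAtMost-padd 0 (a ∷ []) (pmul q (pcomp p q)) [] (degreeAtMost-zeros 0 (zeros-pmulʳ q (zeros-pcomp q zp)))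
degreeAtMost-pcomp (suc D) D′ (a ∷ p) q zp zq =
  degreeAtMost-padd (D′ + D * D′) (a ∷ []) (pmul q (pcomp p q)) (degreeAtMost-mono {D′ = D′ + D * D′} (a ∷ []) z≤n [])
    (degreeAtMost-pmul D′ (D * D′) q (pcomp p q) zq (degreeAtMost-pcomp D D′ p q zp zq))

degreeAtMost-iter : ∀ {d} f → DegreeAtMost d f → ∀ n → DegreeAtMost (d ^ n) (iter f n)
degreeAtMost-iter f zf zero    = []
degreeAtMost-iter f zf (suc n) = degreeAtMost-pcomp _ _ f (iter f n) zf (degreeAtMost-iter f zf n)

degreeAtMost-derivAux : ∀ D k p → DegreeAtMost D p → DegreeAtMost D (derivAux k p)
degreeAtMost-derivAux D       k []      z = []
degreeAtMost-derivAux zero    k (a ∷ p) z = zeros-derivAux (suc k) z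
degreeAtMost-derivAux (suc D) k (a ∷ p) z = degreeAtMost-derivAux D (suc k) p z

degreeAtMost-deriv : ∀ D f → DegreeAtMost (suc D) f → DegreeAtMost D (deriv f)
degreeAtMost-deriv D []      z = []
degreeAtMost-deriv D (a ∷ p) z = degreeAtMost-derivAux D 1 p z

dropWhile-zeros-++ : ∀ {us} vs → Zeros us → dropWhile (ℚP._≟ 0ℚ) (us ++ vs) ≡ dropWhile (ℚP._≟ 0ℚ) vs
dropWhile-zeros-++ vs []         = refl
dropWhile-zeros-++ vs (refl ∷ z) = dropWhile-zeros-++ vs z

length-dropWhile≤ : ∀ xs → length (dropWhile (ℚP._≟ 0ℚ) xs) ≤ length xs
length-dropWhile≤ xs = subst (length (dropWhile P xs) ≤_)
  (trans (sym (LP.length-++ (takeWhile P xs))) (cong length (LP.takeWhile++dropWhile P xs)))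
  (ℕP.m≤n+m _ (length (takeWhile P xs)))
  where P = ℚP._≟ 0ℚ

deg-++-zeros≤ : ∀ xs {zs} → Zeros zs → deg (xs ++ zs) ≤ length xs ∸ 1
deg-++-zeros≤ xs {zs} z = ℕP.∸-monoˡ-≤ 1 (begin
  length (reverse (dropWhile P (reverse (xs ++ zs))))  ≡⟨ LP.length-reverse (dropWhile P (reverse (xs ++ zs))) ⟩
  length (dropWhile P (reverse (xs ++ zs)))            ≡⟨ cong (λ w → length (dropWhile P w)) (LP.reverse-++ xs zs) ⟩
  length (dropWhile P (reverse zs ++ reverse xs))      ≡⟨ cong length (dropWhile-zeros-++ (reverse xs) (zeros-reverse z)) ⟩
  length (dropWhile P (reverse xs))                    ≤⟨ length-dropWhile≤ (reverse xs) ⟩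
  length (reverse xs)                                  ≡⟨ LP.length-reverse xs ⟩
  length xs                                            ∎)
  where
  open ℕP.≤-Reasoning
  P = ℚP._≟ 0ℚ

deg≤ : ∀ D p → DegreeAtMost D p → deg p ≤ D
deg≤ D p z = begin
  deg p                                        ≡⟨ cong deg (LP.take++drop≡id (suc D) p) ⟨
  deg (take (suc D) p ++ drop (suc D) p)       ≤⟨ deg-++-zeros≤ (take (suc D) p) z ⟩
  length (take (suc D) p) ∸ 1                  ≡⟨ cong (_∸ 1) (LP.length-take (suc D) p) ⟩
  suc D ⊓ length p ∸ 1                         ≤⟨ ℕP.∸-monoˡ-≤ 1 (ℕP.m⊓n≤m (suc D) (length p)) ⟩
  D                                            ∎
  where open ℕP.≤-Reasoning

zeros-drop-++ : ∀ n xs {zs} → length xs ≤ n → Zeros zs → Zeros (drop n (xs ++ zs))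
zeros-drop-++ n       []       _         z = AllP.drop⁺ n z
zeros-drop-++ (suc n) (x ∷ xs) (s≤s le) z = zeros-drop-++ n xs le z

degreeAtMost-deg : ∀ p → DegreeAtMost (deg p) p
degreeAtMost-deg p = subst (DegreeAtMost (deg p)) (sym p≡trim++zeros)
  (zeros-drop-++ (suc (deg p)) (trim p) (ℕP.m≤n+m∸n (length (trim p)) 1)
    (zeros-reverse (AllP.all-takeWhile P (reverse p))))
  where
  open ≡-Reasoning
  P = ℚP._≟ 0ℚ
  p≡trim++zeros : p ≡ trim p ++ reverse (takeWhile P (reverse p))
  p≡trim++zeros = begin
    p                                                            ≡⟨ LP.reverse-involutive p ⟨
    reverse (reverse p)                                          ≡⟨ cong reverse (LP.takeWhile++dropWhile P (reverse p)) ⟨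
    reverse (takeWhile P (reverse p) ++ dropWhile P (reverse p)) ≡⟨ LP.reverse-++ (takeWhile P (reverse p)) _ ⟩
    trim p ++ reverse (takeWhile P (reverse p))                  ∎

-- Bounded polynomials

-- E · p has integer coefficients whose absolute values sum to at most B.
data ScaledPoly (E : ℕ) : ℕ → Poly → Set where
  []   : ∀ {B} → ScaledPoly E B []
  cons : ∀ {B b B′ a p} → ScaledInt E b a → ScaledPoly E B′ p → b + B′ ≤ B → ScaledPoly E B (a ∷ p)

scaledPoly-mono : ∀ {E B B′ p} → B ≤ B′ → ScaledPoly E B p → ScaledPoly E B′ p
scaledPoly-mono B≤B′ []            = []
scaledPoly-mono B≤B′ (cons h hs le) = cons h hs (ℕP.≤-trans le B≤B′)

scaledPoly-const : ∀ {E b a} → ScaledInt E b a → ScaledPoly E b (a ∷ [])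
scaledPoly-const {b = b} h = cons h ([] {B = 0}) (ℕP.≤-reflexive (ℕP.+-identityʳ b))

scaledPoly-zeros : ∀ {E B p} → Zeros p → ScaledPoly E B p
scaledPoly-zeros []         = []
scaledPoly-zeros (refl ∷ z) = cons scaledInt-0 (scaledPoly-zeros z) z≤n

scaledPoly-coef : ∀ {E B p} → ScaledPoly E B p → ∀ t → ScaledInt E B (coef p t)
scaledPoly-coef []                           t       = scaledInt-mono z≤n scaledInt-0
scaledPoly-coef (cons {b = b} {B′} h hs le) zero    = scaledInt-mono (ℕP.≤-trans (ℕP.m≤m+n b B′) le) h
scaledPoly-coef (cons {b = b} {B′} h hs le) (suc t) = scaledInt-mono (ℕP.≤-trans (ℕP.m≤n+m B′ b) le) (scaledPoly-coef hs t)

scaledPoly-padd : ∀ {E B C p q} → ScaledPoly E B p → ScaledPoly E C q → ScaledPoly E (B + C) (padd p q)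
scaledPoly-padd {B = B} {C} []             hq = scaledPoly-mono (ℕP.m≤n+m C B) hq
scaledPoly-padd {B = B} {C} hp@(cons _ _ _) [] = scaledPoly-mono (ℕP.m≤m+n B C) hp
scaledPoly-padd (cons {b = b} {B′} h hs le) (cons {b = c} {C′} h′ hs′ le′) =
  cons (scaledInt-+ h h′) (scaledPoly-padd hs hs′)
    (ℕP.≤-trans (ℕP.≤-reflexive (interchange b c B′ C′)) (ℕP.+-mono-≤ le le′))
  where
  interchange : ∀ b c B′ C′ → b + c + (B′ + C′) ≡ b + B′ + (c + C′)
  interchange = ℕSolver.solve-∀

scaledPoly-rescale : ∀ {E B p} k → ScaledPoly E B p → ScaledPoly (E * k) (B * k) p
scaledPoly-rescale k [] = []
scaledPoly-rescale k (cons {b = b} {B′} h hs le) =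
  cons (scaledInt-rescale k h) (scaledPoly-rescale k hs)
    (ℕP.≤-trans (ℕP.≤-reflexive (sym (ℕP.*-distribʳ-+ k b B′))) (ℕP.*-monoˡ-≤ k le))

scaledPoly-scale : ∀ {E F b B a q} → ScaledInt E b a → ScaledPoly F B q → ScaledPoly (E * F) (b * B) (scale a q)
scaledPoly-scale h [] = []
scaledPoly-scale {b = b} h (cons {b = c} {C′} h′ hs le) =
  cons (scaledInt-* h h′) (scaledPoly-scale h hs)
    (ℕP.≤-trans (ℕP.≤-reflexive (sym (ℕP.*-distribˡ-+ b c C′))) (ℕP.*-monoʳ-≤ b le))

scaledPoly-pmul : ∀ {E F B C p q} → ScaledPoly E B p → ScaledPoly F C q → ScaledPoly (E * F) (B * C) (pmul p q)
scaledPoly-pmul [] hq = []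
scaledPoly-pmul {C = C} (cons {b = b} {B′} h hs le) hq =
  scaledPoly-mono (ℕP.≤-trans (ℕP.≤-reflexive (sym (ℕP.*-distribʳ-+ C b B′))) (ℕP.*-monoˡ-≤ C le))
    (scaledPoly-padd (scaledPoly-scale h hq) (cons scaledInt-0 (scaledPoly-pmul hs hq) ℕP.≤-refl))

-- The i-th coefficient of p meets i factors q in Horner's scheme, so its denominator must be
-- padded by F ^ (D - i); F ≤ C keeps the padded numerators within B · C ^ D.
scaledPoly-pcomp : ∀ {E F B C} D p q → ScaledPoly E B p → DegreeAtMost D p → ScaledPoly F C q → F ≤ C →
                   ScaledPoly (E * F ^ D) (B * C ^ D) (pcomp p q)
scaledPoly-pcomp D [] q [] zp hq F≤C = []
scaledPoly-pcomp zero (a ∷ p) q (cons {B} {b} {B′} h hs le) zp hq F≤C =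
  scaledPoly-mono b*1+0≤B*1
    (scaledPoly-padd (scaledPoly-rescale 1 (scaledPoly-const h))
      (scaledPoly-zeros {B = 0} (zeros-pmulʳ q (zeros-pcomp q zp))))
  where
  b*1+0≤B*1 : b * 1 + 0 ≤ B * 1
  b*1+0≤B*1 = ℕP.≤-trans (ℕP.≤-reflexive (ℕP.+-identityʳ (b * 1))) (ℕP.*-monoˡ-≤ 1 (ℕP.≤-trans (ℕP.m≤m+n b B′) le))
scaledPoly-pcomp {E} {F} {B} {C} (suc D) (a ∷ p) q (cons {b = b} {B′} h hs le) zp hq F≤C =
  scaledPoly-mono bound (scaledPoly-padd (scaledPoly-rescale (F ^ suc D) (scaledPoly-const h)) tail)
  where
  tail : ScaledPoly (E * F ^ suc D) (C * (B′ * C ^ D)) (pmul q (pcomp p q))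
  tail = subst (λ e → ScaledPoly e (C * (B′ * C ^ D)) (pmul q (pcomp p q))) (swap F E (F ^ D))
           (scaledPoly-pmul hq (scaledPoly-pcomp D p q hs zp hq F≤C))
    where
    swap : ∀ F E G → F * (E * G) ≡ E * (F * G)
    swap = ℕSolver.solve-∀
  bound : b * F ^ suc D + C * (B′ * C ^ D) ≤ B * C ^ suc D
  bound = begin
    b * F ^ suc D + C * (B′ * C ^ D) ≤⟨ ℕP.+-monoˡ-≤ _ (ℕP.*-monoʳ-≤ b (ℕP.^-monoˡ-≤ (suc D) F≤C)) ⟩
    b * C ^ suc D + C * (B′ * C ^ D) ≡⟨ factor b C B′ (C ^ D) ⟩
    (b + B′) * C ^ suc D             ≤⟨ ℕP.*-monoˡ-≤ (C ^ suc D) le ⟩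
    B * C ^ suc D                    ∎
    where
    open ℕP.≤-Reasoning
    factor : ∀ b C B′ G → b * (C * G) + C * (B′ * G) ≡ (b + B′) * (C * G)
    factor = ℕSolver.solve-∀

commonDenom : Poly → ℕ
commonDenom []      = 1
commonDenom (a ∷ p) = ↧ₙ a * commonDenom p

scaledNorm : Poly → ℕ
scaledNorm []      = 0
scaledNorm (a ∷ p) = ∣ ↥ a ∣ * commonDenom p + ↧ₙ a * scaledNorm p

scaledPoly-canonical : ∀ p → ScaledPoly (commonDenom p) (scaledNorm p) p
scaledPoly-canonical []      = []
scaledPoly-canonical (a ∷ p) =
  cons (scaledInt-rescale (commonDenom p) (scaledInt-self a))
    (subst₂ (λ E B → ScaledPoly E B p) (ℕP.*-comm (commonDenom p) (↧ₙ a)) (ℕP.*-comm (scaledNorm p) (↧ₙ a))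
      (scaledPoly-rescale (↧ₙ a) (scaledPoly-canonical p)))
    ℕP.≤-refl

commonDenom≥1 : ∀ p → 1 ≤ commonDenom p
commonDenom≥1 []                = s≤s z≤n
commonDenom≥1 (mkℚ _ d _ ∷ p) = ℕP.*-mono-≤ (s≤s (z≤n {d})) (commonDenom≥1 p)

height : Poly → ℕ
height p = scaledNorm p + commonDenom p

scaledPoly-height : ∀ p → ScaledPoly (commonDenom p) (height p) p
scaledPoly-height p = scaledPoly-mono (ℕP.m≤m+n (scaledNorm p) (commonDenom p)) (scaledPoly-canonical p)

commonDenom≤height : ∀ p → commonDenom p ≤ height p
commonDenom≤height p = ℕP.m≤n+m (commonDenom p) (scaledNorm p)

height≥1 : ∀ p → 1 ≤ height p
height≥1 p = ℕP.≤-trans (commonDenom≥1 p) (commonDenom≤height p)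

-- Determinants

prod : ∀ {n} → (Fin n → ℕ) → ℕ
prod = foldr _*_ 1

record RowBound {n} (E R : ℕ) (v : Fin n → ℚ) : Set where
  constructor rowBound
  field
    bound : Fin n → ℕ
    entry : ∀ j → ScaledInt E (bound j) (v j)
    sum≤  : sum bound ≤ R

rowBound-removeAt : ∀ {n E R} {v : Fin (suc n) → ℚ} j → RowBound E R v → RowBound E R (removeAt v j)
rowBound-removeAt j (rowBound b h s) =
  rowBound (removeAt b j) (h ∘ punchIn j)
    (ℕP.≤-trans (subst (sum (removeAt b j) ≤_) (sym (sum-remove b)) (ℕP.m≤n+m _ (b j))) s)

scaledInt-sumFin : ∀ {E} n {g : Fin n → ℚ} (c : Fin n → ℕ) → (∀ j → ScaledInt E (c j) (g j)) →
                   ScaledInt E (sum c) (sumFin n g)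
scaledInt-sumFin zero    c h = scaledInt-0
scaledInt-sumFin (suc n) c h = scaledInt-+ (h zero) (scaledInt-sumFin n (c ∘ suc) (h ∘ suc))

det-scaledInt : ∀ n (M : Fin n → Fin n → ℚ) (E R : Fin n → ℕ) → (∀ i → RowBound (E i) (R i) (M i)) →
                ScaledInt (prod E) (prod R) (det n M)
det-scaledInt zero    M E R rows = scaledInt-1
det-scaledInt (suc n) M E R rows =
  scaledInt-mono bound (scaledInt-sumFin (suc n) (λ j → RowBound.bound first j * Q) term)
  where
  first = rows zero
  Q = prod (R ∘ suc)
  minor : ∀ j → ScaledInt (prod (E ∘ suc)) Q (det n (λ r → removeAt (M (suc r)) j))
  minor j = det-scaledInt n (λ r → removeAt (M (suc r)) j) (E ∘ suc) (R ∘ suc)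
              (λ r → rowBound-removeAt j (rows (suc r)))
  term : ∀ j → ScaledInt (prod E) (RowBound.bound first j * Q)
                 (sign (toℕ j) ℚ.* (M zero j ℚ.* det n (λ r → removeAt (M (suc r)) j)))
  term j = scaledInt-sign (toℕ j) (scaledInt-* (RowBound.entry first j) (minor j))
  bound : sum (λ j → RowBound.bound first j * Q) ≤ R zero * Q
  bound = ℕP.≤-trans (ℕP.≤-reflexive (sym (*-distribʳ-sum Q (RowBound.bound first))))
                     (ℕP.*-monoˡ-≤ Q (RowBound.sum≤ first))

-- The resultant

≤ᵇ-suc : ∀ i j → (suc i ≤ᵇ suc j) ≡ (i ≤ᵇ j)
≤ᵇ-suc zero    j = refl
≤ᵇ-suc (suc i) j = refl

-- Same condition as in `shifted`, so that a single `with` decides both.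
window : ℕ → ℕ → ℕ → ℕ → ℕ
window i e B j = if (i ≤ᵇ j) ∧ ((j ∸ i) ≤ᵇ e) then B else 0

window-suc : ∀ i e B j → window (suc i) e B (suc j) ≡ window i e B j
window-suc i e B j = cong (λ t → if t ∧ ((j ∸ i) ≤ᵇ e) then B else 0) (≤ᵇ-suc i j)

window-0-suc : ∀ e B j → window 0 (suc e) B (suc j) ≡ window 0 e B j
window-0-suc e B j = cong (λ t → if t then B else 0) (≤ᵇ-suc j e)

sum-window : ∀ N i e B → sum {N} (window i e B ∘ toℕ) ≤ suc e * B
sum-window zero    i       e       B = z≤n
sum-window (suc N) zero    zero    B = ℕP.≤-reflexive (cong (_+_ B) (sum-replicate-zero N))
sum-window (suc N) zero    (suc e) B =
  ℕP.+-monoʳ-≤ B (ℕP.≤-trans (ℕP.≤-reflexive (sum-cong-≗ {N} (window-0-suc e B ∘ toℕ))) (sum-window N 0 e B))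
sum-window (suc N) (suc i) e       B =
  ℕP.≤-trans (ℕP.≤-reflexive (sum-cong-≗ {N} (window-suc i e B ∘ toℕ))) (sum-window N i e B)

shifted-rowBound : ∀ {E B} N p e i → ScaledPoly E B p → RowBound {N} E (suc e * B) (λ c → shifted p e i (toℕ c))
shifted-rowBound {E} {B} N p e i hp = rowBound (window i e B ∘ toℕ) entry (sum-window N i e B)
  where
  entry : ∀ c → ScaledInt E (window i e B (toℕ c)) (shifted p e i (toℕ c))
  entry c with (i ≤ᵇ toℕ c) ∧ ((toℕ c ∸ i) ≤ᵇ e)
  ... | true  = scaledPoly-coef hp (e ∸ (toℕ c ∸ i))
  ... | false = scaledInt-0

pRow? : ℕ → ∀ {N} → Fin N → Bool
pRow? k r = suc (toℕ r) ≤ᵇ k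

sylvester-rowBound : ∀ {Ep Bp Eq Bq} p q m k → ScaledPoly Ep Bp p → ScaledPoly Eq Bq q → (r : Fin (m + k)) →
  RowBound (if pRow? k r then Ep else Eq) (if pRow? k r then suc m * Bp else suc k * Bq) (sylvester p q m k r)
sylvester-rowBound p q m k hp hq r with pRow? k r
... | true  = shifted-rowBound (m + k) p m (toℕ r) hp
... | false = shifted-rowBound (m + k) q k (toℕ r ∸ k) hq

prod-pRow? : ∀ N k x y → prod {N} (λ r → if pRow? k r then x else y) ≡ x ^ (k ⊓ N) * y ^ (N ∸ k)
prod-pRow? zero    zero    x y = refl
prod-pRow? zero    (suc k) x y = refl
prod-pRow? (suc N) zero    x y =
  trans (cong (y *_) (trans (prod-pRow? N 0 x y) (ℕP.*-identityˡ (y ^ N)))) (sym (ℕP.*-identityˡ (y * y ^ N)))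
prod-pRow? (suc N) (suc k) x y =
  trans (cong (x *_) (prod-pRow? N k x y)) (sym (ℕP.*-assoc x (x ^ (k ⊓ N)) (y ^ (N ∸ k))))

prod-sylvester : ∀ m k x y → prod {m + k} (λ r → if pRow? k r then x else y) ≡ x ^ k * y ^ m
prod-sylvester m k x y =
  trans (prod-pRow? (m + k) k x y)
    (cong₂ (λ s t → x ^ s * y ^ t) (ℕP.m≤n⇒m⊓n≡m (ℕP.m≤n+m k m)) (ℕP.m+n∸n≡m m k))

Res-scaledInt : ∀ {Ep Bp Eq Bq} p q → ScaledPoly Ep Bp p → ScaledPoly Eq Bq q →
  ScaledInt (Ep ^ deg q * Eq ^ deg p) ((suc (deg p) * Bp) ^ deg q * (suc (deg q) * Bq) ^ deg p) (Res p q)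
Res-scaledInt {Ep} {Bp} {Eq} {Bq} p q hp hq =
  subst₂ (λ E B → ScaledInt E B (Res p q)) (prod-sylvester m k Ep Eq) (prod-sylvester m k (suc m * Bp) (suc k * Bq))
    (det-scaledInt (m + k) (sylvester p q m k) _ _ (sylvester-rowBound p q m k hp hq))
  where
  m = deg p
  k = deg q

Res-bounds : ∀ {Ep Bp Eq Bq} p q → ScaledPoly Ep Bp p → ScaledPoly Eq Bq q → 1 ≤ Ep → 1 ≤ Eq → Ep ≤ Bp → Eq ≤ Bq →
  let T = (suc (deg p) * Bp) ^ deg q * (suc (deg q) * Bq) ^ deg p in
  ↧ₙ Res p q ≤ T × ∣ ↥ Res p q ∣ ≤ T
Res-bounds {Ep} {Bp} {Eq} {Bq} p q hp hq 1≤Ep 1≤Eq Ep≤Bp Eq≤Bq =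
  ℕP.≤-trans (proj₁ bounds) denom≤T , proj₂ bounds
  where
  instance
    _ : NonZero Ep
    _ = ℕ.>-nonZero 1≤Ep
    _ : NonZero Eq
    _ = ℕ.>-nonZero 1≤Eq
  m = deg p
  k = deg q
  T = (suc m * Bp) ^ k * (suc k * Bq) ^ m
  bounds : ↧ₙ Res p q ≤ Ep ^ k * Eq ^ m × ∣ ↥ Res p q ∣ ≤ T
  bounds = scaledInt⇒bounds (ℕP.*-mono-≤ (ℕP.m^n>0 Ep k) (ℕP.m^n>0 Eq m)) (Res-scaledInt p q hp hq)
  denom≤T : Ep ^ k * Eq ^ m ≤ T
  denom≤T = ℕP.*-mono-≤ (ℕP.^-monoˡ-≤ k (ℕP.≤-trans Ep≤Bp (ℕP.m≤m+n Bp (m * Bp))))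
                        (ℕP.^-monoˡ-≤ m (ℕP.≤-trans Eq≤Bq (ℕP.m≤m+n Bq (k * Bq))))

-- Iterates

-- E ^ (1 + d + ⋯ + d ^ (n - 1))
iterBound : ℕ → ℕ → ℕ → ℕ
iterBound E d zero    = 1
iterBound E d (suc n) = E * iterBound E d n ^ d

iterBound-mono : ∀ {E B} d n → E ≤ B → iterBound E d n ≤ iterBound B d n
iterBound-mono d zero    E≤B = ℕP.≤-refl
iterBound-mono d (suc n) E≤B = ℕP.*-mono-≤ E≤B (ℕP.^-monoˡ-≤ d (iterBound-mono d n E≤B))

iterBound≥1 : ∀ {E} d n → 1 ≤ E → 1 ≤ iterBound E d n
iterBound≥1 d zero    1≤E = ℕP.≤-refl
iterBound≥1 d (suc n) 1≤E =
  ℕP.*-mono-≤ 1≤E (ℕP.m^n>0 (iterBound _ d n) {{ℕ.>-nonZero (iterBound≥1 d n 1≤E)}} d)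

scaledPoly-iter : ∀ {E B d} f → ScaledPoly E B f → DegreeAtMost d f → E ≤ B →
                  ∀ n → ScaledPoly (iterBound E d n) (iterBound B d n) (iter f n)
scaledPoly-iter f hf zf E≤B zero    = cons scaledInt-0 (scaledPoly-const scaledInt-1) ℕP.≤-refl
scaledPoly-iter {d = d} f hf zf E≤B (suc n) =
  scaledPoly-pcomp d f (iter f n) hf zf (scaledPoly-iter f hf zf E≤B n) (iterBound-mono d n E≤B)

^-distribʳ-* : ∀ a b n → (a * b) ^ n ≡ a ^ n * b ^ n
^-distribʳ-* a b zero    = refl
^-distribʳ-* a b (suc n) = trans (cong (a * b *_) (^-distribʳ-* a b n)) (interchange a b (a ^ n) (b ^ n))
  where
  interchange : ∀ a b x y → a * b * (x * y) ≡ a * x * (b * y)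
  interchange = ℕSolver.solve-∀

^-comm : ∀ x m n → (x ^ m) ^ n ≡ (x ^ n) ^ m
^-comm x m n = trans (ℕP.^-*-assoc x m n) (trans (cong (x ^_) (ℕP.*-comm m n)) (sym (ℕP.^-*-assoc x n m)))

-- (d - 1)(1 + d + ⋯ + d ^ (n - 1)) + 1 = d ^ n
iterBound-^-pred : ∀ B d₀ n → iterBound B (suc d₀) n ^ d₀ * B ≡ B ^ (suc d₀ ^ n)
iterBound-^-pred B d₀ zero    =
  trans (cong (_* B) (ℕP.^-zeroˡ d₀)) (trans (ℕP.*-identityˡ B) (sym (ℕP.^-identityʳ B)))
iterBound-^-pred B d₀ (suc n) = begin
  (B * X ^ d) ^ d₀ * B       ≡⟨ cong (_* B) (^-distribʳ-* B (X ^ d) d₀) ⟩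
  B ^ d₀ * (X ^ d) ^ d₀ * B  ≡⟨ cong (λ t → B ^ d₀ * t * B) (^-comm X d d₀) ⟩
  B ^ d₀ * (X ^ d₀) ^ d * B  ≡⟨ rearrange B (B ^ d₀) ((X ^ d₀) ^ d) ⟩
  B ^ d * (X ^ d₀) ^ d       ≡⟨ ^-distribʳ-* B (X ^ d₀) d ⟨
  (B * X ^ d₀) ^ d           ≡⟨ cong (_^ d) (trans (ℕP.*-comm B (X ^ d₀)) (iterBound-^-pred B d₀ n)) ⟩
  (B ^ (d ^ n)) ^ d          ≡⟨ ℕP.^-*-assoc B (d ^ n) d ⟩
  B ^ (d ^ n * d)            ≡⟨ cong (B ^_) (ℕP.*-comm (d ^ n) d) ⟩
  B ^ (d * d ^ n)            ∎
  where
  open ≡-Reasoning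
  d = suc d₀
  X = iterBound B d n
  rearrange : ∀ B C Y → C * Y * B ≡ B * C * Y
  rearrange = ℕSolver.solve-∀

suc≤2^ : ∀ n → suc n ≤ 2 ^ n
suc≤2^ zero    = ℕP.≤-refl
suc≤2^ (suc n) = ℕP.≤-trans (ℕP.+-mono-≤ (ℕP.m^n>0 2 n) (suc≤2^ n))
                            (ℕP.≤-reflexive (cong (_+_ (2 ^ n)) (sym (ℕP.+-identityʳ (2 ^ n)))))

sylvesterBound≤ : ∀ {d₀ D m k Bn B Bq} → m ≤ D → k ≤ d₀ → 1 ≤ Bn → 1 ≤ B → 1 ≤ Bq → Bn ^ d₀ * B ≡ B ^ D →
  (suc m * Bn) ^ k * (suc k * Bq) ^ m ≤ (2 ^ d₀ * B * (suc d₀ * Bq)) ^ D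
sylvesterBound≤ {d₀} {D} {m} {k} {Bn} {B} {Bq} m≤D k≤d₀ 1≤Bn 1≤B 1≤Bq Bn^d₀*B≡B^D = begin
  (suc m * Bn) ^ k * (suc k * Bq) ^ m   ≤⟨ ℕP.*-mono-≤ pRows qRows ⟩
  (2 ^ d₀ * B) ^ D * (suc d₀ * Bq) ^ D  ≡⟨ ^-distribʳ-* (2 ^ d₀ * B) (suc d₀ * Bq) D ⟨
  (2 ^ d₀ * B * (suc d₀ * Bq)) ^ D      ∎
  where
  open ℕP.≤-Reasoning
  instance
    _ : NonZero B
    _ = ℕ.>-nonZero 1≤B
    _ : NonZero (suc m * Bn)
    _ = ℕ.>-nonZero (ℕP.*-mono-≤ (s≤s (z≤n {m})) 1≤Bn)
    _ : NonZero (suc d₀ * Bq)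
    _ = ℕ.>-nonZero (ℕP.*-mono-≤ (s≤s (z≤n {d₀})) 1≤Bq)
  pRows : (suc m * Bn) ^ k ≤ (2 ^ d₀ * B) ^ D
  pRows = begin
    (suc m * Bn) ^ k              ≤⟨ ℕP.^-monoʳ-≤ (suc m * Bn) k≤d₀ ⟩
    (suc m * Bn) ^ d₀             ≡⟨ ^-distribʳ-* (suc m) Bn d₀ ⟩
    suc m ^ d₀ * Bn ^ d₀          ≤⟨ ℕP.*-mono-≤ (ℕP.^-monoˡ-≤ d₀ (ℕP.≤-trans (s≤s m≤D) (suc≤2^ D)))
                                                 (ℕP.m≤m*n (Bn ^ d₀) B) ⟩
    (2 ^ D) ^ d₀ * (Bn ^ d₀ * B)  ≡⟨ cong₂ _*_ (^-comm 2 D d₀) Bn^d₀*B≡B^D ⟩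
    (2 ^ d₀) ^ D * B ^ D          ≡⟨ ^-distribʳ-* (2 ^ d₀) B D ⟨
    (2 ^ d₀ * B) ^ D              ∎
  qRows : (suc k * Bq) ^ m ≤ (suc d₀ * Bq) ^ D
  qRows = ℕP.≤-trans (ℕP.^-monoˡ-≤ m (ℕP.*-monoˡ-≤ Bq (s≤s k≤d₀))) (ℕP.^-monoʳ-≤ (suc d₀ * Bq) m≤D)

lemma2p8 : (f : Poly) (d : ℕ) → deg f ≡ d → 1 ≤ d →
    ∃ λ (K : ℕ) → (n : ℕ) → 1 ≤ n →
      (∣ ↥ Res (iter f n) (deriv f) ∣ ≤ K ^ (d ^ n)) × (↧ₙ Res (iter f n) (deriv f) ≤ K ^ (d ^ n))
lemma2p8 f (suc d₀) deg≡d (s≤s z≤n) = K , bounds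
  where
  d = suc d₀
  q = deriv f
  K = 2 ^ d₀ * height f * (d * height q)
  f-deg≤d : DegreeAtMost d f
  f-deg≤d = subst (λ t → DegreeAtMost t f) deg≡d (degreeAtMost-deg f)
  bounds : ∀ n → 1 ≤ n → ∣ ↥ Res (iter f n) q ∣ ≤ K ^ (d ^ n) × ↧ₙ Res (iter f n) q ≤ K ^ (d ^ n)
  bounds n _ = ℕP.≤-trans (proj₂ Res≤T) T≤K^dⁿ , ℕP.≤-trans (proj₁ Res≤T) T≤K^dⁿ
    where
    g = iter f n
    Bₙ = iterBound (height f) d n
    T = (suc (deg g) * Bₙ) ^ deg q * (suc (deg q) * height q) ^ deg g
    Res≤T : ↧ₙ Res g q ≤ T × ∣ ↥ Res g q ∣ ≤ T
    Res≤T = Res-bounds g q (scaledPoly-iter f (scaledPoly-height f) f-deg≤d (commonDenom≤height f) n)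
              (scaledPoly-height q) (iterBound≥1 d n (commonDenom≥1 f)) (commonDenom≥1 q)
              (iterBound-mono d n (commonDenom≤height f)) (commonDenom≤height q)
    T≤K^dⁿ : T ≤ K ^ (d ^ n)
    T≤K^dⁿ = sylvesterBound≤ (deg≤ (d ^ n) g (degreeAtMost-iter f f-deg≤d n))
               (deg≤ d₀ q (degreeAtMost-deriv d₀ f f-deg≤d))
               (iterBound≥1 d n (height≥1 f)) (height≥1 f) (height≥1 q) (iterBound-^-pred (height f) d₀ n)
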